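{- Let $F$ be a polybox contained in a $d$-box $X$. If there is a proper suit for $F$ with exactly $2^d$ elements, then $F=X$.
   Context: A $d$-box is $X=X_1\times\cdots\times X_d$ with finite nonempty sets $X_i$. A box is a nonempty $A_1\times\cdots\times A_d$ with $A_i\subseteq X_i$, proper if $A_i\neq X_i$ for all $i$. Boxes $A,B$ are dichotomous if $A_i=X_i\setminus B_i$ for some $i$. A suit is a family of pairwise dichotomous boxes, proper if all its boxes are proper, and it is a suit for $F$ if its union is $F$; a nonempty $F\subseteq X$ is a polybox if some suit is a suit for $F$. -}

module Defs where

open import Data.Nat using (ℕ; suc; _^_)
open import Data.Fin using (Fin)
open import Data.Fin.Subset using (Subset; ⊤; ∁) renaming (_∈_ to _∈ˢ_)
open import Data.Product using (Σ; ∃; ∃-syntax; _×_)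
open import Relation.Nullary using (¬_)
open import Relation.Binary.PropositionalEquality using (_≡_; _≢_)
open import Function.Bundles using (_⇔_)

-- A d-box X = X₀ × ⋯ × X_{d-1}: each Xᵢ is a finite nonempty set,
-- represented (up to bijection) by Fin (suc (m i)).
Sides : ℕ → Set
Sides d = Fin d → ℕ

Factor : ∀ {d} → Sides d → Fin d → Set
Factor m i = Fin (suc (m i))

Point : ∀ {d} → Sides d → Set
Point {d} m = (i : Fin d) → Factor m i

Product : ∀ {d} → Sides d → Set
Product {d} m = (i : Fin d) → Subset (suc (m i))

_∈P_ : ∀ {d} {m : Sides d} → Point m → Product m → Set
x ∈P A = ∀ i → x i ∈ˢ A i

IsBox : ∀ {d} {m : Sides d} → Product m → Set
IsBox {m = m} A = ∃[ x ] (x ∈P A)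

record Box {d} (m : Sides d) : Set where
  constructor box
  field
    sides : Product m
    nonempty : IsBox sides
open Box public

ProperBox : ∀ {d} {m : Sides d} → Box m → Set
ProperBox {d} A = (i : Fin d) → sides A i ≢ ⊤

Dichotomous : ∀ {d} {m : Sides d} → Box m → Box m → Set
Dichotomous A B = ∃[ i ] (sides A i ≡ ∁ (sides B i))

SubsetX : ∀ {d} → Sides d → Set₁
SubsetX m = Point m → Set

record Suit {d} (m : Sides d) (k : ℕ) : Set where
  field
    boxes : Fin k → Box m
    pairwise : ∀ j j′ → j ≢ j′ → Dichotomous (boxes j) (boxes j′)
open Suit public

ProperSuit : ∀ {d} {m : Sides d} {k} → Suit m k → Set
ProperSuit S = ∀ j → ProperBox (boxes S j)

SuitFor : ∀ {d} {m : Sides d} {k} → Suit m k → SubsetX m → Set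
SuitFor S F = ∀ x → F x ⇔ (∃[ j ] (x ∈P sides (boxes S j)))

IsPolybox : ∀ {d} {m : Sides d} → SubsetX m → Set
IsPolybox {m = m} F = (∃[ x ] F x) × (∃[ k ] Σ (Suit m k) λ S → SuitFor S F)

IsWhole : ∀ {d} {m : Sides d} → SubsetX m → Set
IsWhole F = ∀ x → F x

{-# OPTIONS --safe #-}
module Submission where

-- Split a family of pairwise dichotomous products according to whether their
-- first side contains a fixed t ∈ X₀. Two products on the same side of the
-- split cannot be dichotomous in the first coordinate, so dropping it leaves two
-- pairwise dichotomous families in dimension d - 1, and by induction the family
-- has at most 2^d members. If a point x is uncovered, splitting at t = x₀ leaves
-- the rest of x uncovered by the first family, so the bound is strict. Hence any
-- 2^d pairwise dichotomous boxes cover X.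

open import Defs
open import Data.Bool using (Bool; true; false; not)
open import Data.Bool.Properties using (_≟_; not-¬)
open import Data.Nat using (ℕ; zero; suc; _+_; _^_; _≤_; _<_; z≤n; s≤s)
open import Data.Nat.Properties using (+-suc; +-identityʳ; +-mono-≤; +-mono-<-≤; <-irrefl; module ≤-Reasoning)
open import Data.Fin using (Fin) renaming (zero to fzero; suc to fsuc)
open import Data.Fin.Subset using (∁)
open import Data.Fin.Subset.Properties using (_∈?_)
open import Data.Fin.Properties using (any?; all?)
open import Data.Vec using (lookup)
open import Data.Vec.Properties using (lookup-map; lookup⇒[]=)
open import Data.List using (List; []; _∷_; length; map; filter; tabulate)
open import Data.List.Properties using (length-tabulate)
open import Data.List.Relation.Unary.All as All using (All; []; _∷_)
open import Data.List.Relation.Unary.All.Properties as All using (all-filter)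
open import Data.List.Relation.Unary.AllPairs using (AllPairs; []; _∷_)
import Data.List.Relation.Unary.AllPairs.Properties as AllPairs
open import Data.Product using (_×_; _,_; ∃-syntax)
open import Function using (_∘_)
open import Function.Bundles using (Equivalence)
open import Relation.Nullary using (¬_; Dec; contradiction)
open import Relation.Nullary.Decidable using (decidable-stable)
open import Relation.Binary using (Rel)
open import Relation.Binary.PropositionalEquality using (_≡_; _≢_; refl; sym; trans; cong)
open import Relation.Unary using (Pred)

allPairs-within : ∀ {a p r s} {X : Set a} {P : Pred X p} {R : Rel X r} {S : Rel X s} →
  (∀ {x y} → P x → P y → R x y → S x y) →
  ∀ {xs} → All P xs → AllPairs R xs → AllPairs S xs
allPairs-within P⇒R⊆S [] [] = []
allPairs-within P⇒R⊆S (px ∷ pxs) (rx ∷ rxs) =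
  All.zipWith (λ (py , rxy) → P⇒R⊆S px py rxy) (pxs , rx) ∷ allPairs-within P⇒R⊆S pxs rxs

Dichotomousᴾ : ∀ {d} {m : Sides d} → Product m → Product m → Set
Dichotomousᴾ A B = ∃[ i ] (A i ≡ ∁ (B i))

_∈P?_ : ∀ {d} {m : Sides d} (x : Point m) (A : Product m) → Dec (x ∈P A)
x ∈P? A = all? (λ i → x i ∈? A i)

_∉⋃_ : ∀ {d} {m : Sides d} → Point m → List (Product m) → Set
x ∉⋃ L = All (λ A → ¬ x ∈P A) L

module FirstCoordinate {d} {m : Sides (suc d)} where

  slice : Bool → Factor m fzero → List (Product m) → List (Product (m ∘ fsuc))
  slice b t L = map (_∘ fsuc) (filter (λ A → lookup (A fzero) t ≟ b) L)

  length-slices : ∀ t L → length L ≡ length (slice true t L) + length (slice false t L)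
  length-slices t [] = refl
  length-slices t (A ∷ L) with lookup (A fzero) t
  ... | true  = cong suc (length-slices t L)
  ... | false = trans (cong suc (length-slices t L)) (sym (+-suc _ _))

  dichotomous-tail : ∀ {b t} {A B : Product m} →
    lookup (A fzero) t ≡ b → lookup (B fzero) t ≡ b →
    Dichotomousᴾ A B → Dichotomousᴾ (A ∘ fsuc) (B ∘ fsuc)
  dichotomous-tail {b} {t} {B = B} A₀t≡b B₀t≡b (fzero , A₀≡∁B₀) =
    contradiction b≡not[B₀t] (not-¬ (sym B₀t≡b))
    where
    b≡not[B₀t] : b ≡ not (lookup (B fzero) t)
    b≡not[B₀t] = trans (sym A₀t≡b) (trans (cong (λ S → lookup S t) A₀≡∁B₀) (lookup-map t _ (B fzero)))
  dichotomous-tail _ _ (fsuc i , Aᵢ≡∁Bᵢ) = i , Aᵢ≡∁Bᵢ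

  slice-dichotomous : ∀ b t {L} → AllPairs Dichotomousᴾ L → AllPairs Dichotomousᴾ (slice b t L)
  slice-dichotomous b t {L} dich =
    AllPairs.map⁺ (allPairs-within dichotomous-tail (all-filter _ L) (AllPairs.filter⁺ _ dich))

  slice-∉⋃ : ∀ (x : Point m) {L} → x ∉⋃ L → (x ∘ fsuc) ∉⋃ slice true (x fzero) L
  slice-∉⋃ x {L} x∉L = All.map⁺ (All.zipWith tail-∉ (All.filter⁺ _ x∉L , all-filter _ L))
    where
    tail-∉ : ∀ {A} → ¬ x ∈P A × lookup (A fzero) (x fzero) ≡ true → ¬ (x ∘ fsuc) ∈P (A ∘ fsuc)
    tail-∉ {A} (x∉A , A₀∋x₀) x′∈A′ = x∉A λ where
      fzero    → lookup⇒[]= (x fzero) (A fzero) A₀∋x₀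
      (fsuc i) → x′∈A′ i

open FirstCoordinate

2^d+2^d≡2^[1+d] : ∀ d → 2 ^ d + 2 ^ d ≡ 2 ^ suc d
2^d+2^d≡2^[1+d] d = cong (2 ^ d +_) (sym (+-identityʳ (2 ^ d)))

dichotomous-length≤ : ∀ d {m : Sides d} (L : List (Product m)) →
  AllPairs Dichotomousᴾ L → length L ≤ 2 ^ d
dichotomous-length≤ zero []          _ = z≤n
dichotomous-length≤ zero (A ∷ [])    _ = s≤s z≤n
dichotomous-length≤ zero (A ∷ B ∷ L) (((() , _) ∷ _) ∷ _)
dichotomous-length≤ (suc d) L dich = begin
  length L                                                   ≡⟨ length-slices fzero L ⟩
  length (slice true fzero L) + length (slice false fzero L) ≤⟨ +-mono-≤ (ih true) (ih false) ⟩
  2 ^ d + 2 ^ d                                              ≡⟨ 2^d+2^d≡2^[1+d] d ⟩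
  2 ^ suc d                                                  ∎
  where
  open ≤-Reasoning
  ih : ∀ b → length (slice b fzero L) ≤ 2 ^ d
  ih b = dichotomous-length≤ d _ (slice-dichotomous b fzero dich)

dichotomous-length< : ∀ d {m : Sides d} (L : List (Product m)) →
  AllPairs Dichotomousᴾ L → (x : Point m) → x ∉⋃ L → length L < 2 ^ d
dichotomous-length< zero    []      _ _ _           = s≤s z≤n
dichotomous-length< zero    (A ∷ L) _ _ (x∉A ∷ _)   = contradiction (λ ()) x∉A
dichotomous-length< (suc d) L dich x x∉L = begin-strict
  length L                                           ≡⟨ length-slices t L ⟩
  length (slice true t L) + length (slice false t L) <⟨ +-mono-<-≤ ih-through-t ih-avoiding-t ⟩
  2 ^ d + 2 ^ d                                      ≡⟨ 2^d+2^d≡2^[1+d] d ⟩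
  2 ^ suc d                                          ∎
  where
  open ≤-Reasoning
  t = x fzero
  ih-through-t : length (slice true t L) < 2 ^ d
  ih-through-t = dichotomous-length< d _ (slice-dichotomous true t dich) (x ∘ fsuc) (slice-∉⋃ x x∉L)
  ih-avoiding-t : length (slice false t L) ≤ 2 ^ d
  ih-avoiding-t = dichotomous-length≤ d _ (slice-dichotomous false t dich)

dichotomous-covers : ∀ d {m : Sides d} (A : Fin (2 ^ d) → Product m) →
  (∀ j j′ → j ≢ j′ → Dichotomousᴾ (A j) (A j′)) → ∀ x → ∃[ j ] (x ∈P A j)
dichotomous-covers d A dich x = decidable-stable (any? (λ j → x ∈P? A j)) λ x∉⋃A →
  <-irrefl (length-tabulate A)
    (dichotomous-length< d (tabulate A) (AllPairs.tabulate⁺ (dich _ _)) x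
      (All.tabulate⁺ (λ j x∈Aj → x∉⋃A (j , x∈Aj))))

theorem2p5 : (d : ℕ) (m : Sides d) (F : SubsetX m) → IsPolybox F →
    (S : Suit m (2 ^ d)) → ProperSuit S → SuitFor S F → IsWhole F
theorem2p5 d m F _ S _ S-for-F x =
  Equivalence.from (S-for-F x) (dichotomous-covers d (sides ∘ boxes S) (pairwise S) x)
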